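{- Let $p$ be a pattern. Then $p$ is avoidable in the ordinary sense if and only if $p$ is avoidable up to $\simeq$.
   Context: A pattern is a word $p=p_1\cdots p_n$ over an alphabet of variables. For an equivalence relation $\sim$ on words, a word $w$ encounters $p$ up to $\sim$ if $w$ has a factor $X_1X_2\cdots X_n$ with each $X_i$ a nonempty word and $X_i\sim X_j$ whenever $p_i=p_j$; otherwise $w$ avoids $p$ up to $\sim$. The pattern $p$ is $k$-avoidable up to $\sim$ if some infinite word over a $k$-letter alphabet avoids $p$ up to $\sim$, and avoidable up to $\sim$ if it is $k$-avoidable up to $\sim$ for some $k$. "Ordinary sense" means $\sim$ is equality. The relation $\simeq$ is defined by $x\simeq x'$ iff $x'\in\{x,x^R\}$, where $x^R$ is the reversal of $x$. -}

module Defs where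

open import Data.Nat using (ℕ; suc; _+_)
open import Data.Fin using (Fin)
open import Data.List using (List; []; _∷_; length; lookup; concat; tabulate; reverse)
open import Data.Product using (Σ; ∃; _×_; _,_)
open import Data.Sum using (_⊎_)
open import Relation.Nullary using (¬_)
open import Relation.Binary.PropositionalEquality using (_≡_)
open import Function.Bundles using (_⇔_)

WordRel : Set₁
WordRel = {A : Set} → List A → List A → Set

EqRel : WordRel
EqRel x y = x ≡ y

RevRel : WordRel
RevRel x x' = (x' ≡ x) ⊎ (x' ≡ reverse x)

slice : {A : Set} → (ℕ → A) → ℕ → ℕ → List A
slice w i 0       = []
slice w i (suc n) = w i ∷ slice w (suc i) n

NonEmpty : {A : Set} → List A → Set
NonEmpty xs = Σ ℕ λ n → length xs ≡ suc n

Encounters : WordRel → {V A : Set} → List V → (ℕ → A) → Set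
Encounters R {V} {A} p w =
  Σ (Fin (length p) → List A) λ X →
  Σ ℕ λ i →
    ((j : Fin (length p)) → NonEmpty (X j)) ×
    ((j k : Fin (length p)) → lookup p j ≡ lookup p k → R (X j) (X k)) ×
    (concat (tabulate X) ≡ slice w i (length (concat (tabulate X))))

Avoids : WordRel → {V A : Set} → List V → (ℕ → A) → Set
Avoids R p w = ¬ Encounters R p w

KAvoidable : WordRel → {V : Set} → ℕ → List V → Set
KAvoidable R k p = Σ (ℕ → Fin k) λ w → Avoids R p w

Avoidable : WordRel → {V : Set} → List V → Set
Avoidable R p = Σ ℕ λ k → KAvoidable R k p

-- Equality refines ≃, so a word avoiding p up to ≃ avoids it ordinarily.
-- Conversely, if w avoids p over k letters, tag its n-th letter with n mod 3.
-- Along any factor of the tagged word the tags advance cyclically, so no factor of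
-- length ≥ 2 is the reversal of another factor; hence X ≃ Y between blocks of an
-- encounter forces X = Y, and erasing the tags yields an ordinary encounter in w.
module Submission where

open import Defs
open import Level using (Level; 0ℓ)
open import Data.Nat using (ℕ; zero; suc; _*_)
open import Data.Fin using (Fin; zero; suc; combine; remQuot)
open import Data.Fin.Properties using (remQuot-combine)
open import Data.List using (List; []; _∷_; _++_; map; length; lookup; concat; tabulate; reverse)
open import Data.List.Properties using (length-map; reverse-++; concat-map; map-tabulate)
open import Data.List.Relation.Unary.Linked using (Linked; []; [-]; _∷_)
open import Data.Product using (proj₁; proj₂; _,_)
open import Data.Sum using (inj₁; inj₂)
open import Data.Empty using (⊥-elim)
open import Function.Bundles using (_⇔_; mk⇔)
open import Relation.Binary.Core using (Rel)
open import Relation.Binary.Definitions using (Asymmetric)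
open import Relation.Binary.PropositionalEquality
open import Relation.Nullary using (¬_)

module _ {a ℓ : Level} {A : Set a} {R : Rel A ℓ} where

  Linked-++⁻ˡ : ∀ xs {ys} → Linked R (xs ++ ys) → Linked R xs
  Linked-++⁻ˡ []           _           = []
  Linked-++⁻ˡ (_ ∷ [])     _           = [-]
  Linked-++⁻ˡ (_ ∷ y ∷ xs) (Rxy ∷ Rxs) = Rxy ∷ Linked-++⁻ˡ (y ∷ xs) Rxs

  Linked-++⁻ʳ : ∀ xs {ys} → Linked R (xs ++ ys) → Linked R ys
  Linked-++⁻ʳ []                 Rys         = Rys
  Linked-++⁻ʳ (_ ∷ []) {[]}      _           = []
  Linked-++⁻ʳ (_ ∷ []) {_ ∷ _}   (_ ∷ Rys)   = Rys
  Linked-++⁻ʳ (_ ∷ y ∷ xs)       (_ ∷ Rxs)   = Linked-++⁻ʳ (y ∷ xs) Rxs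

  Linked-concat-tabulate⁻ : ∀ {n} (X : Fin n → List A) →
    Linked R (concat (tabulate X)) → ∀ j → Linked R (X j)
  Linked-concat-tabulate⁻ X RX zero    = Linked-++⁻ˡ (X zero) RX
  Linked-concat-tabulate⁻ X RX (suc j) =
    Linked-concat-tabulate⁻ (λ i → X (suc i)) (Linked-++⁻ʳ (X zero) RX) j

  Linked-reverse⇒reverse≡ : Asymmetric R → ∀ xs →
    Linked R xs → Linked R (reverse xs) → reverse xs ≡ xs
  Linked-reverse⇒reverse≡ asym []          _         _     = refl
  Linked-reverse⇒reverse≡ asym (_ ∷ [])    _         _     = refl
  Linked-reverse⇒reverse≡ asym (x ∷ y ∷ r) (Rxy ∷ _) Rrev
    with Linked-++⁻ʳ (reverse r) (subst (Linked R) (reverse-++ (x ∷ y ∷ []) r) Rrev)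
  ... | Ryx ∷ [-] = ⊥-elim (asym Rxy Ryx)

module _ {A : Set} {ℓ : Level} {R : Rel A ℓ} {u : ℕ → A}
         (Ru : ∀ n → R (u n) (u (suc n))) where

  slice-Linked : ∀ i n → Linked R (slice u i n)
  slice-Linked i zero          = []
  slice-Linked i (suc zero)    = [-]
  slice-Linked i (suc (suc n)) = Ru i ∷ slice-Linked (suc i) (suc n)

  -- Blocks are factors of u, hence R-linked, so a block equal to the reversal of
  -- another is a palindrome.
  Encounters-RevRel⇒EqRel : Asymmetric R → {V : Set} (p : List V) →
    Encounters RevRel p u → Encounters EqRel p u
  Encounters-RevRel⇒EqRel asym p (X , i , nonEmpty , related , factor) =
    X , i , nonEmpty , equal , factor
    where
    Linked-block : ∀ j → Linked R (X j)
    Linked-block = Linked-concat-tabulate⁻ X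
      (subst (Linked R) (sym factor) (slice-Linked i _))
    equal : ∀ j k → lookup p j ≡ lookup p k → X j ≡ X k
    equal j k pⱼ≡pₖ with related j k pⱼ≡pₖ
    ... | inj₁ Xₖ≡Xⱼ  = sym Xₖ≡Xⱼ
    ... | inj₂ Xₖ≡Xⱼᴿ = sym (trans Xₖ≡Xⱼᴿ
      (Linked-reverse⇒reverse≡ asym (X j) (Linked-block j)
        (subst (Linked R) Xₖ≡Xⱼᴿ (Linked-block k))))

module _ {A B : Set} (h : B → A) {u : ℕ → B} {w : ℕ → A}
         (hu≗w : ∀ n → h (u n) ≡ w n) where

  map-slice : ∀ i n → map h (slice u i n) ≡ slice w i n
  map-slice i zero    = refl
  map-slice i (suc n) = cong₂ _∷_ (hu≗w i) (map-slice (suc i) n)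

  Encounters-map : {R S : WordRel} → (∀ {x y} → R x y → S (map h x) (map h y)) →
    {V : Set} (p : List V) → Encounters R p u → Encounters S p w
  Encounters-map hRS p (X , i , nonEmpty , related , factor) =
    (λ j → map h (X j)) , i , nonEmpty′ ,
    (λ j k pⱼ≡pₖ → hRS {x = X j} {y = X k} (related j k pⱼ≡pₖ)) , factor′
    where
    open ≡-Reasoning
    C : List B
    C = concat (tabulate X)
    hC : List A
    hC = concat (tabulate (λ j → map h (X j)))
    hC≡mapC : hC ≡ map h C
    hC≡mapC = trans (cong concat (sym (map-tabulate X (map h)))) (concat-map (tabulate X))
    nonEmpty′ : ∀ j → NonEmpty (map h (X j))
    nonEmpty′ j = proj₁ (nonEmpty j) , trans (length-map h (X j)) (proj₂ (nonEmpty j))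
    length-hC : length hC ≡ length C
    length-hC = trans (cong length hC≡mapC) (length-map h C)
    factor′ : hC ≡ slice w i (length hC)
    factor′ = begin
      hC                           ≡⟨ hC≡mapC ⟩
      map h C                      ≡⟨ cong (map h) factor ⟩
      map h (slice u i (length C)) ≡⟨ map-slice i (length C) ⟩
      slice w i (length C)         ≡⟨ cong (slice w i) (sym length-hC) ⟩
      slice w i (length hC)        ∎

Encounters-mono : {R S : WordRel} → (∀ {A} {x y : List A} → R x y → S x y) →
  {V A : Set} (p : List V) {w : ℕ → A} → Encounters R p w → Encounters S p w
Encounters-mono R⇒S p (X , i , nonEmpty , related , factor) =
  X , i , nonEmpty , (λ j k pⱼ≡pₖ → R⇒S {x = X j} {y = X k} (related j k pⱼ≡pₖ)) , factor

Avoidable-antitone : {R S : WordRel} → (∀ {A} {x y : List A} → R x y → S x y) →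
  {V : Set} (p : List V) → Avoidable S p → Avoidable R p
Avoidable-antitone {R} {S} R⇒S p (k , w , avoids) =
  k , w , λ encounter → avoids (Encounters-mono {R} {S} R⇒S p encounter)

EqRel⇒RevRel : ∀ {A} {x y : List A} → EqRel x y → RevRel x y
EqRel⇒RevRel x≡y = inj₁ (sym x≡y)

tick : Fin 3 → Fin 3
tick zero             = suc zero
tick (suc zero)       = suc (suc zero)
tick (suc (suc zero)) = zero

tick²≢id : ∀ x → ¬ tick (tick x) ≡ x
tick²≢id zero             ()
tick²≢id (suc zero)       ()
tick²≢id (suc (suc zero)) ()

clock : ℕ → Fin 3
clock zero    = zero
clock (suc n) = tick (clock n)

module Tagging {k : ℕ} (w : ℕ → Fin k) where

  tagged : ℕ → Fin (k * 3)
  tagged n = combine (w n) (clock n)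

  untag : Fin (k * 3) → Fin k
  untag b = proj₁ (remQuot {k} 3 b)

  tag : Fin (k * 3) → Fin 3
  tag b = proj₂ (remQuot {k} 3 b)

  Ticks : Rel (Fin (k * 3)) 0ℓ
  Ticks b c = tag c ≡ tick (tag b)

  Ticks-asym : Asymmetric Ticks
  Ticks-asym {b} {c} bc cb = tick²≢id (tag b) (sym (trans cb (cong tick bc)))

  tag-tagged : ∀ n → tag (tagged n) ≡ clock n
  tag-tagged n = cong proj₂ (remQuot-combine (w n) (clock n))

  untag-tagged : ∀ n → untag (tagged n) ≡ w n
  untag-tagged n = cong proj₁ (remQuot-combine (w n) (clock n))

  tagged-Ticks : ∀ n → Ticks (tagged n) (tagged (suc n))
  tagged-Ticks n = trans (tag-tagged (suc n)) (cong tick (sym (tag-tagged n)))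

  Encounters-RevRel-tagged⇒Encounters : {V : Set} (p : List V) →
    Encounters RevRel p tagged → Encounters EqRel p w
  Encounters-RevRel-tagged⇒Encounters p encounter =
    Encounters-map untag untag-tagged {EqRel} {EqRel} (cong (map untag)) p
      (Encounters-RevRel⇒EqRel {u = tagged} tagged-Ticks
        (λ {b} {c} → Ticks-asym {b} {c}) p encounter)

KAvoidable-tagging : {V : Set} {k : ℕ} (p : List V) →
  KAvoidable EqRel k p → KAvoidable RevRel (k * 3) p
KAvoidable-tagging p (w , avoids) =
  tagged , λ encounter → avoids (Encounters-RevRel-tagged⇒Encounters p encounter)
  where open Tagging w

theorem6 : {V : Set} (p : List V) → Avoidable EqRel p ⇔ Avoidable RevRel p
theorem6 p = mk⇔ (λ (k , avoidable) → k * 3 , KAvoidable-tagging p avoidable)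
                 (Avoidable-antitone {EqRel} {RevRel} EqRel⇒RevRel p)
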